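{- Let $d\ge1$, $n\ge 2$, and $1\le i\le n-1$. Put $U=u_iu_{i-1}\cdots u_1u_0\in Bl_{d,n}$. Then for $k\in[1,n]$: (i) $z_kU=Uz_k$ if $k>i+1$; $z_kU=Uz_{k+2}$ if $1\le k\le i-1$; $z_kU=z_{i+1}U$ if $k=i$; $z_kU=z_iU$ if $k=i+1$. (ii) $Uz_k=z_kU$ if $k>i+1$; $Uz_k=z_{k-2}U$ if $3\le k\le i+1$.
   Context: $Bl_{d,n}$ is the monoid generated by $u_0,\dots,u_{n-1},z_1,\dots,z_n$ with relations: $u_i^2=u_i$; $u_iu_j=u_ju_i$ for $|i-j|>1$; $u_1u_0u_1=u_1$; $u_iu_ju_i=u_i$ for $|i-j|=1$, $i,j\neq0$; $z_i^d=1$, $z_iz_j=z_jz_i$; $z_iu_i=z_{i+1}u_i$ and $u_iz_i=u_iz_{i+1}$ for $1\le i\le n-1$; $u_0z_i=z_iu_0$ for $i\ne 1$; $u_iz_j=z_ju_i$ for $1\le i\le n-1$, $j\notin\{i,i+1\}$; $u_iz_i^ku_i=u_i$ for $1\le i\le n-1$, $k\in\mathbb{Z}$; $u_1z_1^ku_0u_1=u_1$ and $u_1u_0z_1^ku_1=u_1$ for $k\in\mathbb{Z}$. -}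

module Defs where

open import Data.Nat using (ℕ; zero; suc; _+_; _≤_; _<_)
open import Data.Nat.Properties using (<-trans; n<1+n)
open import Data.Fin using (Fin; toℕ; fromℕ<)
open import Data.Fin.Properties using (toℕ<n)
open import Data.List using (List; []; _∷_; _++_; replicate)
open import Relation.Binary.PropositionalEquality using (_≡_; _≢_)
open import Data.Sum using (_⊎_)

-- Generators of Bl_{d,n}.
--   u a  (a : Fin n)  stands for  u_{toℕ a}        (u_0 , … , u_{n-1})
--   z b  (b : Fin n)  stands for  z_{suc (toℕ b)}  (z_1 , … , z_n)
data Gen (n : ℕ) : Set where
  u : Fin n → Gen n
  z : Fin n → Gen n

zi : ∀ {n} → Fin n → ℕ
zi b = suc (toℕ b)

ui : ∀ {n} → Fin n → ℕ
ui a = toℕ a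

Word : ℕ → Set
Word n = List (Gen n)

zpow : ∀ {n} → Fin n → ℕ → Word n
zpow b k = replicate k (z b)

data Rel (d n : ℕ) : Word n → Word n → Set where
  uu-idem : ∀ a → Rel d n (u a ∷ u a ∷ []) (u a ∷ [])
  uu-comm : ∀ a b → 2 + ui a ≤ ui b → Rel d n (u a ∷ u b ∷ []) (u b ∷ u a ∷ [])
  u1u0u1 : ∀ a b → ui a ≡ 1 → ui b ≡ 0 → Rel d n (u a ∷ u b ∷ u a ∷ []) (u a ∷ [])
  uuu : ∀ a b → 1 ≤ ui a → 1 ≤ ui b → (ui b ≡ suc (ui a) ⊎ ui a ≡ suc (ui b)) →
        Rel d n (u a ∷ u b ∷ u a ∷ []) (u a ∷ [])
  z-order : ∀ b → Rel d n (zpow b d) []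
  zz-comm : ∀ b c → Rel d n (z b ∷ z c ∷ []) (z c ∷ z b ∷ [])
  zu-shift : ∀ a b c → 1 ≤ ui a → zi b ≡ ui a → zi c ≡ suc (ui a) →
             Rel d n (z b ∷ u a ∷ []) (z c ∷ u a ∷ [])
  uz-shift : ∀ a b c → 1 ≤ ui a → zi b ≡ ui a → zi c ≡ suc (ui a) →
             Rel d n (u a ∷ z b ∷ []) (u a ∷ z c ∷ [])
  u0z-comm : ∀ a b → ui a ≡ 0 → zi b ≢ 1 → Rel d n (u a ∷ z b ∷ []) (z b ∷ u a ∷ [])
  uz-comm : ∀ a b → 1 ≤ ui a → zi b ≢ ui a → zi b ≢ suc (ui a) →
            Rel d n (u a ∷ z b ∷ []) (z b ∷ u a ∷ [])
  uzu : ∀ a b k → 1 ≤ ui a → zi b ≡ ui a →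
        Rel d n (u a ∷ zpow b k ++ u a ∷ []) (u a ∷ [])
  u1z1u0u1 : ∀ a b c k → ui a ≡ 1 → zi b ≡ 1 → ui c ≡ 0 →
             Rel d n (u a ∷ zpow b k ++ u c ∷ u a ∷ []) (u a ∷ [])
  u1u0z1u1 : ∀ a b c k → ui a ≡ 1 → zi b ≡ 1 → ui c ≡ 0 →
             Rel d n (u a ∷ u c ∷ zpow b k ++ u a ∷ []) (u a ∷ [])

data _≈⟨_⟩_ {n : ℕ} : Word n → ℕ → Word n → Set where
  ≈-rel   : ∀ {d v w} → Rel d n v w → v ≈⟨ d ⟩ w
  ≈-refl  : ∀ {d w} → w ≈⟨ d ⟩ w
  ≈-sym   : ∀ {d v w} → v ≈⟨ d ⟩ w → w ≈⟨ d ⟩ v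
  ≈-trans : ∀ {d v w x} → v ≈⟨ d ⟩ w → w ≈⟨ d ⟩ x → v ≈⟨ d ⟩ x
  ≈-cong  : ∀ {d v w} (p q : Word n) → v ≈⟨ d ⟩ w → (p ++ v ++ q) ≈⟨ d ⟩ (p ++ w ++ q)

uDown : ∀ {n} (k : ℕ) → k < n → Word n
uDown zero p = u (fromℕ< p) ∷ []
uDown {n} (suc k) p = u (fromℕ< p) ∷ uDown k (<-trans (n<1+n k) p)

Uword : ∀ {n} → Fin n → Word n
Uword i = uDown (toℕ i) (toℕ<n i)

-- Every letter u_j of U commutes with z_k unless k ∈ {j, j+1} (k = 1 for j = 0), so a z_k with
-- k > i+1 passes U untouched, and z_i, z_{i+1} are identified by the leading u_i.  A z_k with
-- k < i first commutes past u_i ⋯ u_{k+2}; at the pair u_{k+1} u_k the relations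
-- z_k u_k = z_{k+1} u_k and u_{k+1} z_{k+1} = u_{k+1} z_{k+2} turn it into z_{k+2}, which then
-- commutes with the rest u_{k-1} ⋯ u_0.
module Submission where

open import Defs
open import Data.Nat using (ℕ; zero; suc; _+_; _≤_; _<_; z≤n; s≤s)
open import Data.Nat.Properties using (<⇒≢; >⇒≢; m<n⇒m<1+n; n<1+n; <-trans; m<1+n⇒m≤n; m<1+n⇒m<n∨m≡n; +-comm)
open import Data.Fin using (Fin; toℕ; fromℕ<)
open import Data.Fin.Properties using (toℕ-fromℕ<; toℕ<n)
open import Data.List using (_∷_; []; _++_)
open import Data.List.Properties using (++-identityʳ)
open import Data.Product using (_×_; _,_; proj₁; proj₂)
open import Data.Sum using (_⊎_; inj₁; inj₂)
open import Relation.Binary.PropositionalEquality using (_≡_; _≢_; refl; sym; trans; cong; subst; subst₂)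

≈-prefix : ∀ {d n} (p : Word n) {v w : Word n} → v ≈⟨ d ⟩ w → (p ++ v) ≈⟨ d ⟩ (p ++ w)
≈-prefix p {v} {w} e =
  subst₂ (λ v′ w′ → (p ++ v′) ≈⟨ _ ⟩ (p ++ w′)) (++-identityʳ v) (++-identityʳ w) (≈-cong p [] e)

apart⇒≢ : ∀ {x m} → x < m ⊎ suc m < x → x ≢ m × x ≢ suc m
apart⇒≢ (inj₁ x<m) = <⇒≢ x<m , <⇒≢ (m<n⇒m<1+n x<m)
apart⇒≢ (inj₂ m<x) = >⇒≢ (<-trans (n<1+n _) m<x) , >⇒≢ m<x

module _ {d n : ℕ} where

  open import Relation.Binary.Reasoning.Base.Single (λ (v w : Word n) → v ≈⟨ d ⟩ w) ≈-refl ≈-trans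

  z∷u-comm : ∀ {m} (p : m < n) (b : Fin n) → zi b < m ⊎ suc m < zi b →
             (z b ∷ u (fromℕ< p) ∷ []) ≈⟨ d ⟩ (u (fromℕ< p) ∷ z b ∷ [])
  z∷u-comm {zero} p b (inj₂ 1<b) = ≈-sym (≈-rel (u0z-comm (fromℕ< p) b (toℕ-fromℕ< p) (>⇒≢ 1<b)))
  z∷u-comm {suc m} p b apart =
    ≈-sym (≈-rel (uz-comm (fromℕ< p) b (subst (1 ≤_) 1+m≡a (s≤s z≤n))
                          (subst (zi b ≢_) 1+m≡a b≢m) (subst (λ x → zi b ≢ suc x) 1+m≡a b≢1+m)))
    where
    1+m≡a = sym (toℕ-fromℕ< p)
    b≢m = proj₁ (apart⇒≢ apart)
    b≢1+m = proj₂ (apart⇒≢ apart)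

  z∷u-shift : ∀ {m} (p : m < n) (b c : Fin n) → zi b ≡ m → zi c ≡ suc m →
              (z b ∷ u (fromℕ< p) ∷ []) ≈⟨ d ⟩ (z c ∷ u (fromℕ< p) ∷ [])
  z∷u-shift p b c b≡m c≡1+m = ≈-rel (zu-shift (fromℕ< p) b c
    (subst (1 ≤_) (trans b≡m m≡a) (s≤s z≤n)) (trans b≡m m≡a) (trans c≡1+m (cong suc m≡a)))
    where m≡a = sym (toℕ-fromℕ< p)

  u∷z-shift : ∀ {m} (p : m < n) (b c : Fin n) → zi b ≡ m → zi c ≡ suc m →
              (u (fromℕ< p) ∷ z b ∷ []) ≈⟨ d ⟩ (u (fromℕ< p) ∷ z c ∷ [])
  u∷z-shift p b c b≡m c≡1+m = ≈-rel (uz-shift (fromℕ< p) b c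
    (subst (1 ≤_) (trans b≡m m≡a) (s≤s z≤n)) (trans b≡m m≡a) (trans c≡1+m (cong suc m≡a)))
    where m≡a = sym (toℕ-fromℕ< p)

  z∷uu-shift₂ : ∀ {m} (p : suc m < n) (q : m < n) (k k′ : Fin n) → zi k ≡ m → zi k′ ≡ suc (suc m) →
                (z k ∷ u (fromℕ< p) ∷ u (fromℕ< q) ∷ []) ≈⟨ d ⟩ (u (fromℕ< p) ∷ u (fromℕ< q) ∷ z k′ ∷ [])
  z∷uu-shift₂ {m} p q k k′ k≡m k′≡2+m = begin
    z k ∷ a ∷ b ∷ []       ∼⟨ ≈-cong [] (b ∷ []) (z∷u-comm p k (inj₁ (subst (_< suc m) (sym k≡m) (n<1+n m)))) ⟩
    a ∷ z k ∷ b ∷ []       ∼⟨ ≈-prefix (a ∷ []) (z∷u-shift q k (fromℕ< q) k≡m b≡1+m) ⟩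
    a ∷ z (fromℕ< q) ∷ b ∷ [] ∼⟨ ≈-cong [] (b ∷ []) (u∷z-shift p (fromℕ< q) k′ b≡1+m k′≡2+m) ⟩
    a ∷ z k′ ∷ b ∷ []      ∼⟨ ≈-prefix (a ∷ []) (z∷u-comm q k′ (inj₂ (subst (suc m <_) (sym k′≡2+m) (n<1+n _)))) ⟩
    a ∷ b ∷ z k′ ∷ []      ∎
    where
    a = u (fromℕ< p)
    b = u (fromℕ< q)
    b≡1+m : zi (fromℕ< q) ≡ suc m
    b≡1+m = cong suc (toℕ-fromℕ< q)

  z∷uDown-comm : ∀ m (p : m < n) (k : Fin n) → suc m < zi k →
                 (z k ∷ uDown m p) ≈⟨ d ⟩ (uDown m p ++ z k ∷ [])
  z∷uDown-comm zero p k 1<k = z∷u-comm p k (inj₂ 1<k)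
  z∷uDown-comm (suc m) p k 2+m<k = begin
    z k ∷ a ∷ R           ∼⟨ ≈-cong [] R (z∷u-comm p k (inj₂ 2+m<k)) ⟩
    a ∷ z k ∷ R           ∼⟨ ≈-prefix (a ∷ []) (z∷uDown-comm m q k (<-trans (n<1+n _) 2+m<k)) ⟩
    a ∷ R ++ z k ∷ []     ∎
    where
    q = <-trans (n<1+n m) p
    a = u (fromℕ< p)
    R = uDown m q

  z∷uDown-shift₂ : ∀ m (p : m < n) (k k′ : Fin n) → zi k < m → zi k′ ≡ 2 + zi k →
                   (z k ∷ uDown m p) ≈⟨ d ⟩ (uDown m p ++ z k′ ∷ [])
  z∷uDown-shift₂ zero p k k′ () k′≡2+k
  z∷uDown-shift₂ (suc m) p k k′ k<1+m k′≡2+k with m<1+n⇒m<n∨m≡n k<1+m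
  ... | inj₁ k<m = begin
    z k ∷ a ∷ R           ∼⟨ ≈-cong [] R (z∷u-comm p k (inj₁ (<-trans k<m (n<1+n m)))) ⟩
    a ∷ z k ∷ R           ∼⟨ ≈-prefix (a ∷ []) (z∷uDown-shift₂ m q k k′ k<m k′≡2+k) ⟩
    a ∷ R ++ z k′ ∷ []    ∎
    where
    q = <-trans (n<1+n m) p
    a = u (fromℕ< p)
    R = uDown m q
  ... | inj₂ refl = begin
    z k ∷ a ∷ b ∷ R       ∼⟨ ≈-cong [] R (z∷uu-shift₂ p q k k′ refl k′≡2+k) ⟩
    a ∷ b ∷ z k′ ∷ R      ∼⟨ ≈-prefix (a ∷ b ∷ []) (z∷uDown-comm (toℕ k) r k′ k<k′) ⟩
    a ∷ b ∷ R ++ z k′ ∷ [] ∎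
    where
    q = <-trans (n<1+n m) p
    r = <-trans (n<1+n (toℕ k)) q
    a = u (fromℕ< p)
    b = u (fromℕ< q)
    R = uDown (toℕ k) r
    k<k′ : zi k < zi k′
    k<k′ = subst (zi k <_) (sym k′≡2+k) (m<n⇒m<1+n (n<1+n (zi k)))

  z∷uDown-absorb : ∀ m (p : m < n) (k k′ : Fin n) → zi k ≡ m → zi k′ ≡ suc m →
                   (z k ∷ uDown m p) ≈⟨ d ⟩ (z k′ ∷ uDown m p)
  z∷uDown-absorb (suc m) p k k′ k≡m k′≡1+m =
    ≈-cong [] (uDown m (<-trans (n<1+n m) p)) (z∷u-shift p k k′ k≡m k′≡1+m)

lemma4p6 : (d n : ℕ) → 1 ≤ d → 2 ≤ n → (i : Fin n) → 1 ≤ toℕ i →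
  ((k : Fin n) → suc (toℕ i) < zi k →
     (z k ∷ Uword i) ≈⟨ d ⟩ (Uword i ++ z k ∷ [])) ×
  ((k k′ : Fin n) → zi k + 1 ≤ toℕ i → zi k′ ≡ zi k + 2 →
     (z k ∷ Uword i) ≈⟨ d ⟩ (Uword i ++ z k′ ∷ [])) ×
  ((k k′ : Fin n) → zi k ≡ toℕ i → zi k′ ≡ suc (toℕ i) →
     (z k ∷ Uword i) ≈⟨ d ⟩ (z k′ ∷ Uword i)) ×
  ((k k′ : Fin n) → zi k ≡ suc (toℕ i) → zi k′ ≡ toℕ i →
     (z k ∷ Uword i) ≈⟨ d ⟩ (z k′ ∷ Uword i)) ×
  ((k : Fin n) → suc (toℕ i) < zi k →
     (Uword i ++ z k ∷ []) ≈⟨ d ⟩ (z k ∷ Uword i)) ×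
  ((k k′ : Fin n) → 3 ≤ zi k → zi k ≤ suc (toℕ i) → zi k′ + 2 ≡ zi k →
     (Uword i ++ z k ∷ []) ≈⟨ d ⟩ (z k′ ∷ Uword i))
lemma4p6 _ _ _ _ i _ =
  (λ k i<k → z∷uDown-comm m p k i<k) ,
  (λ k k′ k+1≤i k′≡k+2 →
     z∷uDown-shift₂ m p k k′ (subst (_≤ m) (+-comm (zi k) 1) k+1≤i) (trans k′≡k+2 (+-comm (zi k) 2))) ,
  (λ k k′ k≡i k′≡1+i → z∷uDown-absorb m p k k′ k≡i k′≡1+i) ,
  (λ k k′ k≡1+i k′≡i → ≈-sym (z∷uDown-absorb m p k′ k k′≡i k≡1+i)) ,
  (λ k i<k → ≈-sym (z∷uDown-comm m p k i<k)) ,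
  (λ k k′ _ k≤1+i k′+2≡k →
     let k≡2+k′ = trans (sym k′+2≡k) (+-comm (zi k′) 2)
     in ≈-sym (z∷uDown-shift₂ m p k′ k (m<1+n⇒m≤n (subst (_≤ suc m) k≡2+k′ k≤1+i)) k≡2+k′))
  where
  m = toℕ i
  p = toℕ<n i
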